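{- Let $p$ be a prime, $d\geq 2$ with $d\mid p-1$, $A,C\in\mathbb{F}_p$ with $A\neq 0$, $f(X)=AX^d+C$, $\gamma\in\mathbb{F}_p$ a fixed primitive $d$-th root of unity, and $k\geq 1$. For every $r\geq 0$ and every complete proper $(r-1,k,d)$-graph $G$, the variety $\mathcal{C}_G$ is a subvariety of $$\mathcal{C}_r:\ X_0^{d^r}f^{\circ r}\!\left(\tfrac{X_1}{X_0}\right)=\dots=X_0^{d^r}f^{\circ r}\!\left(\tfrac{X_k}{X_0}\right)\ \subset\mathbb{P}^k.$$
   Context: Iterates: $f^{\circ 0}(X)=X$, $f^{\circ(j+1)}=f\circ f^{\circ j}$. An $(r,k,d)$-graph is a graph $G$ with vertex set $\{1,\dots,k\}$ together with, for each edge $\overline{ab}$, values $\xi_G(a,b),\xi_G(b,a)\in\{ -1,\dots,r\}$ and $\eta_G(a,b),\eta_G(b,a)\in\{0,\dots,d-1\}$ such that $\xi_G(a,b)=\xi_G(b,a)$, $\eta_G(a,b)+\eta_G(b,a)\equiv 0\pmod d$, $\eta=0$ when $\xi=-1$, and $\eta\in\{1,\dots,d-1\}$ when $\xi\geq 0$. Complete: every pair of distinct vertices is joined. Proper: for all distinct vertices $a,b,c$ with $\overline{ab},\overline{ac},\overline{bc}$ edges: (1) if $\xi_G(a,b)=\xi_G(b,c)=-1$ then $\xi_G(a,c)=-1$; (2) if $\xi_G(a,b)<\xi_G(b,c)$ then $\xi_G(a,c)=\xi_G(b,c)$ and $\eta_G(a,c)=\eta_G(b,c)$; (3) if $0\leq\xi_G(a,b)=\xi_G(b,c)$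 and $\eta_G(a,b)+\eta_G(b,c)\neq d$ then $\xi_G(a,c)=\xi_G(a,b)$ and $\eta_G(a,c)\equiv\eta_G(a,b)+\eta_G(b,c)\pmod d$; (4) if $0\leq\xi_G(a,b)=\xi_G(b,c)$ and $\eta_G(a,b)+\eta_G(b,c)=d$ then $\xi_G(a,c)<\xi_G(a,b)$. $\Phi(X,Y,Z;-1,0)=X-Y$ and, for $\ell\geq 0$, $1\leq h\leq d-1$, $\Phi(X,Y,Z;\ell,h)=Z^{d^\ell}\big(f^{\circ\ell}(X/Z)-\gamma^h f^{\circ\ell}(Y/Z)\big)$. $\mathcal{C}_G\subset\mathbb{P}^k$ (coordinates $(X_0:\dots:X_k)$) is defined by $\Phi(X_a,X_b,X_0;\xi_G(a,b),\eta_G(a,b))=0$ for all edges $\overline{ab}$ of $G$. -}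

module Defs where

open import Level using (Level; _⊔_)
open import Data.Nat as ℕ using (ℕ; zero; suc)
open import Data.Nat.Divisibility as ℕD using ()
open import Data.Integer as ℤ using (ℤ; +_; -[1+_])
open import Data.Integer.Divisibility as ℤD using ()
open import Data.Fin using (Fin) renaming (zero to fz; suc to fs)
open import Data.Bool using (Bool; true)
open import Data.Product using (Σ; ∃; _×_)
open import Relation.Binary.PropositionalEquality using (_≡_; _≢_)
open import Relation.Nullary using (¬_)
open import Algebra.Bundles using (CommutativeRing)

-- Arithmetic in F_p, with elements of F_p represented by naturals
-- (congruence mod p as equality).

_≡[mod_]_ : ℕ → ℕ → ℕ → Set
x ≡[mod p ] y = (+ p) ℤD.∣ ((+ x) ℤ.- (+ y))

PrimitiveRoot : (p d γ : ℕ) → Set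
PrimitiveRoot p d γ =
  ((γ ℕ.^ d) ≡[mod p ] 1) ×
  (∀ j → 1 ℕ.≤ j → j ℕ.< d → ¬ ((γ ℕ.^ j) ≡[mod p ] 1))

module _ {c ℓ : Level} (K : CommutativeRing c ℓ) where
  open CommutativeRing K

  record IsField : Set (c ⊔ ℓ) where
    field
      nontrivial : ¬ (1# ≈ 0#)
      inverse    : ∀ x → ¬ (x ≈ 0#) → Σ Carrier (λ y → (x * y) ≈ 1#)

  embed : ℕ → Carrier
  embed zero    = 0#
  embed (suc n) = 1# + embed n

  -- K has characteristic p (p a prime), i.e. F_p ⊆ K
  HasCharacteristic : ℕ → Set ℓ
  HasCharacteristic p = embed p ≈ 0#

  pow : Carrier → ℕ → Carrier
  pow x zero    = 1#
  pow x (suc n) = x * pow x n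

  -- Homogenised iterate:  F ℓ' X Z = Z^{d^ℓ'} f^{∘ℓ'}(X/Z)  for
  -- f(X) = a X^d + c', i.e. F 0 X Z = X,
  -- F (ℓ'+1) X Z = a (F ℓ' X Z)^d + c' Z^{d^{ℓ'+1}}.
  Fhom : (d : ℕ) (a c' : Carrier) → ℕ → Carrier → Carrier → Carrier
  Fhom d a c' zero    X Z = X
  Fhom d a c' (suc m) X Z =
    (a * pow (Fhom d a c' m X Z) d) + (c' * pow Z (d ℕ.^ suc m))

  -- Φ(X,Y,Z; ξ, η); ξ = -1 gives X - Y (ξ ≥ -1 always for graphs).
  Φ : (d : ℕ) (a c' g : Carrier) → Carrier → Carrier → Carrier → ℤ → ℕ → Carrier
  Φ d a c' g X Y Z (+ m)    h = Fhom d a c' m X Z - (pow g h * Fhom d a c' m Y Z)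
  Φ d a c' g X Y Z -[1+ _ ] h = X - Y

-- Vertices are Fin k (vertex i ↔ i+1 of the paper).
-- ξ, η are given as total functions, constrained only on edges.
-- ρ is an integer so that (r-1,k,d)-graphs with r = 0 make sense.

record Graph (ρ : ℤ) (k d : ℕ) : Set where
  field
    edge    : Fin k → Fin k → Bool
    irrefl  : ∀ a → ¬ (edge a a ≡ true)
    sym     : ∀ a b → edge a b ≡ true → edge b a ≡ true
    ξ       : Fin k → Fin k → ℤ
    η       : Fin k → Fin k → ℕ
    ξ-low   : ∀ a b → edge a b ≡ true → -[1+ 0 ] ℤ.≤ ξ a b
    ξ-high  : ∀ a b → edge a b ≡ true → ξ a b ℤ.≤ ρ
    η-range : ∀ a b → edge a b ≡ true → η a b ℕ.< d
    ξ-sym   : ∀ a b → edge a b ≡ true → ξ a b ≡ ξ b a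
    η-sum   : ∀ a b → edge a b ≡ true → d ℕD.∣ (η a b ℕ.+ η b a)
    η-neg   : ∀ a b → edge a b ≡ true → ξ a b ≡ -[1+ 0 ] → η a b ≡ 0
    η-pos   : ∀ a b → edge a b ≡ true → (+ 0) ℤ.≤ ξ a b → 1 ℕ.≤ η a b

module _ {ρ : ℤ} {k d : ℕ} (G : Graph ρ k d) where
  open Graph G

  Complete : Set
  Complete = ∀ a b → a ≢ b → edge a b ≡ true

  Proper : Set
  Proper = ∀ a b c → a ≢ b → a ≢ c → b ≢ c →
    edge a b ≡ true → edge a c ≡ true → edge b c ≡ true →
    ((ξ a b ≡ -[1+ 0 ] → ξ b c ≡ -[1+ 0 ] → ξ a c ≡ -[1+ 0 ]) ×
     (ξ a b ℤ.< ξ b c → (ξ a c ≡ ξ b c) × (η a c ≡ η b c)) ×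
     ((+ 0) ℤ.≤ ξ a b → ξ a b ≡ ξ b c → ¬ (η a b ℕ.+ η b c ≡ d) →
        (ξ a c ≡ ξ a b) × ((+ d) ℤD.∣ ((+ η a c) ℤ.- (+ (η a b ℕ.+ η b c))))) ×
     ((+ 0) ℤ.≤ ξ a b → ξ a b ≡ ξ b c → η a b ℕ.+ η b c ≡ d →
        ξ a c ℤ.< ξ a b))

-- Points of P^k over K: representatives X : Fin (suc k) → K, not all
-- zero; coordinate X_0 is X fz, coordinate X_i (i = 1..k) is X (fs (i-1)).

module _ {c ℓ : Level} (K : CommutativeRing c ℓ) where
  open CommutativeRing K

  NonZeroVec : {k : ℕ} → (Fin (suc k) → Carrier) → Set ℓ
  NonZeroVec X = ∃ λ i → ¬ (X i ≈ 0#)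

  InCG : {ρ : ℤ} {k : ℕ} (d A C γ : ℕ) → Graph ρ k d →
         (Fin (suc k) → Carrier) → Set ℓ
  InCG d A C γ G X = ∀ a b → Graph.edge G a b ≡ true →
    Φ K d (embed K A) (embed K C) (embed K γ) (X (fs a)) (X (fs b)) (X fz)
      (Graph.ξ G a b) (Graph.η G a b) ≈ 0#

  InCr : {k : ℕ} (d A C r : ℕ) → (Fin (suc k) → Carrier) → Set ℓ
  InCr d A C r X = ∀ i j →
    Fhom K d (embed K A) (embed K C) r (X (fs i)) (X fz) ≈
    Fhom K d (embed K A) (embed K C) r (X (fs j)) (X fz)

-- On an edge ab with ξ(a,b) = -1 the coordinates X_a and X_b agree; on an
-- edge with ξ(a,b) = ℓ ≥ 0 the homogenised iterates F_ℓ(X_a) and F_ℓ(X_b)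
-- differ by the factor γ^η, which is killed by the d-th power in the next
-- application of f, so F_{ℓ+1}(X_a) = F_{ℓ+1}(X_b).  Since ξ ≤ r - 1 on every
-- edge and G is complete, equality then propagates to F_r for every pair of
-- coordinates.
module Submission where

open import Defs
open import Level using (Level)
open import Data.Nat using (ℕ; suc; _≤_; _∸_)
open import Data.Nat.Divisibility using (_∣_)
open import Data.Nat.Primality using (Prime)
open import Data.Integer using (+_; _-_)
open import Data.Fin using (Fin)
open import Relation.Nullary using (¬_)
open import Algebra.Bundles using (CommutativeRing)

import Data.Nat as ℕ
import Data.Integer as ℤ
open import Data.Nat.Properties using (≤⇒≤′)
open import Data.Nat.Divisibility using (divides; ∣1⇒≡1)
open import Data.Integer.Properties using (drop‿+≤+)
open import Data.Fin using (_≟_)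
open import Data.Bool using (true)
open import Data.Product using (_,_)
open import Relation.Nullary using (yes; no)
open import Relation.Binary.PropositionalEquality as ≡ using (_≡_)

module _ {c ℓ : Level} (K : CommutativeRing c ℓ) where
  open CommutativeRing K hiding (_-_)
  open import Algebra.Properties.Semiring.Exp semiring using (_^_; ^-congˡ)
  open import Algebra.Properties.CommutativeSemiring.Exp commutativeSemiring
    using (^-distrib-*)
  open import Algebra.Properties.Semiring.Mult semiring using (_×_; ×1-homo-*)
  open import Algebra.Properties.Group +-group using (x∙y⁻¹≈ε⇒x≈y)
  open import Relation.Binary.Reasoning.Setoid setoid

  pow≡^ : ∀ x n → pow K x n ≡ x ^ n
  pow≡^ x ℕ.zero    = ≡.refl
  pow≡^ x (suc n) = ≡.cong (x *_) (pow≡^ x n)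

  embed≡×1# : ∀ n → embed K n ≡ n × 1#
  embed≡×1# ℕ.zero    = ≡.refl
  embed≡×1# (suc n) = ≡.cong (_+_ 1#) (embed≡×1# n)

  embed-homo-* : ∀ m n → embed K (m ℕ.* n) ≈ embed K m * embed K n
  embed-homo-* m n = begin
    embed K (m ℕ.* n)        ≡⟨ embed≡×1# (m ℕ.* n) ⟩
    (m ℕ.* n) × 1#           ≈⟨ ×1-homo-* m n ⟩
    (m × 1#) * (n × 1#)      ≡⟨ ≡.cong₂ _*_ (embed≡×1# m) (embed≡×1# n) ⟨
    embed K m * embed K n    ∎

  embed-homo-pow : ∀ x n → embed K (x ℕ.^ n) ≈ pow K (embed K x) n
  embed-homo-pow x ℕ.zero    = +-identityʳ 1#
  embed-homo-pow x (suc n) =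
    trans (embed-homo-* x (x ℕ.^ n)) (*-congˡ (embed-homo-pow x n))

  -- For p = 1 the hypothesis forces K to be trivial, so no primality is needed.
  embed-≡1[mod] : ∀ {p} x → HasCharacteristic K p → x ≡[mod p ] 1 → embed K x ≈ 1#
  embed-≡1[mod] {p} ℕ.zero char p∣1 = begin
    0#        ≈⟨ char ⟨
    embed K p ≡⟨ ≡.cong (embed K) (∣1⇒≡1 p∣1) ⟩
    1# + 0#   ≈⟨ +-identityʳ 1# ⟩
    1#        ∎
  embed-≡1[mod] {p} (suc x) char (divides q x≡q*p) = begin
    1# + embed K x               ≡⟨ ≡.cong (λ n → 1# + embed K n) x≡q*p ⟩
    1# + embed K (q ℕ.* p)       ≈⟨ +-congˡ (embed-homo-* q p) ⟩
    1# + embed K q * embed K p   ≈⟨ +-congˡ (*-congˡ char) ⟩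
    1# + embed K q * 0#          ≈⟨ +-congˡ (zeroʳ (embed K q)) ⟩
    1# + 0#                      ≈⟨ +-identityʳ 1# ⟩
    1#                           ∎

  pow-congˡ : ∀ n {x y} → x ≈ y → pow K x n ≈ pow K y n
  pow-congˡ n {x} {y} x≈y = begin
    pow K x n ≡⟨ pow≡^ x n ⟩
    x ^ n     ≈⟨ ^-congˡ n x≈y ⟩
    y ^ n     ≡⟨ pow≡^ y n ⟨
    pow K y n ∎

  1#^≈1# : ∀ n → 1# ^ n ≈ 1#
  1#^≈1# ℕ.zero    = refl
  1#^≈1# (suc n) = trans (*-identityˡ (1# ^ n)) (1#^≈1# n)

  ^-rootOfUnity : ∀ {ζ} d → ζ ^ d ≈ 1# → ∀ h → (ζ ^ h) ^ d ≈ 1#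
  ^-rootOfUnity d ζ^d≈1 ℕ.zero    = 1#^≈1# d
  ^-rootOfUnity {ζ} d ζ^d≈1 (suc h) = begin
    (ζ * ζ ^ h) ^ d      ≈⟨ ^-distrib-* ζ (ζ ^ h) d ⟩
    ζ ^ d * (ζ ^ h) ^ d  ≈⟨ *-cong ζ^d≈1 (^-rootOfUnity d ζ^d≈1 h) ⟩
    1# * 1#              ≈⟨ *-identityˡ 1# ⟩
    1#                   ∎

  pow-cancel-rootOfUnity : ∀ {ζ x y} d h → pow K ζ d ≈ 1# →
                           x ≈ pow K ζ h * y → pow K x d ≈ pow K y d
  pow-cancel-rootOfUnity {ζ} {x} {y} d h ζ^d≈1 x≈ζ^hy = begin
    pow K x d             ≡⟨ pow≡^ x d ⟩
    x ^ d                 ≈⟨ ^-congˡ d x≈ζ^hy ⟩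
    (pow K ζ h * y) ^ d   ≡⟨ ≡.cong (λ t → (t * y) ^ d) (pow≡^ ζ h) ⟩
    (ζ ^ h * y) ^ d       ≈⟨ ^-distrib-* (ζ ^ h) y d ⟩
    (ζ ^ h) ^ d * y ^ d   ≈⟨ *-congʳ (^-rootOfUnity d ζ^d≈1′ h) ⟩
    1# * y ^ d            ≈⟨ *-identityˡ (y ^ d) ⟩
    y ^ d                 ≡⟨ pow≡^ y d ⟨
    pow K y d             ∎
    where
    ζ^d≈1′ : ζ ^ d ≈ 1#
    ζ^d≈1′ = trans (reflexive (≡.sym (pow≡^ ζ d))) ζ^d≈1

  module _ (d : ℕ) (a c′ : Carrier) {X Y Z : Carrier} where
    F : ℕ → Carrier → Carrier → Carrier
    F = Fhom K d a c′

    Fhom-suc-cong : ∀ m → pow K (F m X Z) d ≈ pow K (F m Y Z) d →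
                    F (suc m) X Z ≈ F (suc m) Y Z
    Fhom-suc-cong m Fᵈ≈Fᵈ = +-congʳ (*-congˡ Fᵈ≈Fᵈ)

    Fhom-mono-cong : ∀ {m} n → m ℕ.≤′ n → F m X Z ≈ F m Y Z → F n X Z ≈ F n Y Z
    Fhom-mono-cong n       ℕ.≤′-refl        F≈F = F≈F
    Fhom-mono-cong (suc n) (ℕ.≤′-step m≤′n) F≈F =
      Fhom-suc-cong n (pow-congˡ d (Fhom-mono-cong n m≤′n F≈F))

    Φ≈0⇒Fhom-≈ : ∀ {γ} → pow K γ d ≈ 1# → ∀ r ξ h → ξ ℤ.≤ + r - + 1 →
                 Φ K d a c′ γ X Y Z ξ h ≈ 0# → F r X Z ≈ F r Y Z
    Φ≈0⇒Fhom-≈ _ r ℤ.-[1+ _ ] _ _ X-Y≈0 =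
      Fhom-mono-cong r (≤⇒≤′ ℕ.z≤n) (x∙y⁻¹≈ε⇒x≈y X Y X-Y≈0)
    Φ≈0⇒Fhom-≈ γ^d≈1 (suc r) (+ m) h m≤r Φ≈0 =
      Fhom-mono-cong (suc r) (≤⇒≤′ (ℕ.s≤s (drop‿+≤+ m≤r)))
        (Fhom-suc-cong m (pow-cancel-rootOfUnity d h γ^d≈1 (x∙y⁻¹≈ε⇒x≈y _ _ Φ≈0)))

lemma2p16 : (p : ℕ) → Prime p → (d : ℕ) → 2 ≤ d → d ∣ (p ∸ 1) →
    (A C γ : ℕ) → ¬ (p ∣ A) → PrimitiveRoot p d γ →
    (k : ℕ) → 1 ≤ k → (r : ℕ) →
    (G : Graph ((+ r) - (+ 1)) k d) → Complete G → Proper G →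
    {c ℓ : Level} (K : CommutativeRing c ℓ) → IsField K → HasCharacteristic K p →
    (X : Fin (suc k) → CommutativeRing.Carrier K) → NonZeroVec K X →
    InCG K d A C γ G X → InCr K d A C r X
lemma2p16 p _ d _ _ A C γ _ (γ^d≡1 , _) k _ r G complete _ K _ char X _ X∈CG i j
  with i ≟ j
... | yes ≡.refl = CommutativeRing.refl K
... | no i≢j =
  Φ≈0⇒Fhom-≈ K d (embed K A) (embed K C) embedγ^d≈1 r (ξ i j) (η i j)
    (ξ-high i j i—j) (X∈CG i j i—j)
  where
  open Graph G using (edge; ξ; η; ξ-high)
  open CommutativeRing K using (_≈_; 1#; sym; trans)
  i—j : edge i j ≡ true
  i—j = complete i j i≢j
  embedγ^d≈1 : pow K (embed K γ) d ≈ 1#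
  embedγ^d≈1 = trans (sym (embed-homo-pow K γ d)) (embed-≡1[mod] K (γ ℕ.^ d) char γ^d≡1)
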